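{- If a permutation $\pi\in\mathcal{C}_{1,1}\cap\mathrm{Av}(3142)$ has a spiral decomposition with $m$ blocks, then $G_\pi$ has at most $4m$ bad edges with respect to that decomposition.
   Context: $\mathcal{C}_{1,1}$ is the set of permutations partitionable into one increasing and one decreasing subsequence; $\mathrm{Av}(3142)$ is the set of permutations avoiding the pattern $3142$. For a permutation $\pi=\pi(1),\dots,\pi(n)$, $G_\pi$ has vertex set $\{1,\dots,n\}$ (values of $\pi$), with $\pi(i),\pi(j)$ adjacent iff $|i-j|=1$ or $|\pi(i)-\pi(j)|=1$; such an edge is red if $|\pi(i)-\pi(j)|=1$ and blue if $|i-j|=1$ (possibly both). Element $x$ is above $y$ if $x>y$, left of $y$ if it occurs earlier; for sets the relation holds for all pairs. A spiral decomposition of $\pi$ is a partition of its elements into possibly empty blocks $B_1,\dots,B_m$ such that (a) $B_i$ is decreasing for odd $i$ and increasing for even $i$; (b) with $B_{>i}=\bigcup_{j>i}B_j$ and $r_i$ the remainder of $i$ mod 4: if $r_i=0$, $B_i$ is above $B_{i-1}$ and $B_{>i}$ is above and left of $B_{i-1}$; if $r_i=1$ and $i>1$, $B_i$ is left of $B_{i-1}$ and $B_{>i}$ is below and left of $B_{i-1}$; if $r_i=2$, $B_i$ is below $B_{i-1}$ and $B_{>i}$ is below and right of $B_{i-1}$; if $r_i=3$, $B_i$ is right of $B_{i-1}$ and $B_{>i}$ is above and right of $B_{i-1}$. An edge $xy$ of $G_\pi$ with $x\in B_i$, $y\in B_j$, $i\le j$ is good if $i=j$, or $xy$ is blue, $i$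 odd and $j=i+1$, or $xy$ is red, $i$ even and $j=i+1$; otherwise it is bad. -}

module Defs where

open import Data.Nat using (ℕ; zero; suc; _≤_; _%_; _⊓_; _⊔_)
import Data.Nat as ℕ
open import Data.Fin using (Fin; toℕ; _<_)
open import Data.Bool using (Bool; true; false)
open import Data.Product using (_×_; ∃)
open import Data.Sum using (_⊎_)
open import Relation.Binary.PropositionalEquality using (_≡_)
open import Relation.Nullary using (¬_)
open import Function.Definitions using (Injective)

-- A permutation of length n: positions Fin n (0-based), values Fin n (0-based).
-- π p is the value at position p.  An injective endomap of Fin n is a bijection.
IsPerm : {n : ℕ} → (Fin n → Fin n) → Set
IsPerm π = Injective _≡_ _≡_ π

InC11 : {n : ℕ} → (Fin n → Fin n) → Set
InC11 {n} π = ∃ λ (c : Fin n → Bool) →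
  (∀ p q → p < q → c p ≡ true → c q ≡ true → π p < π q) ×
  (∀ p q → p < q → c p ≡ false → c q ≡ false → π q < π p)

Contains3142 : {n : ℕ} → (Fin n → Fin n) → Set
Contains3142 {n} π = ∃ λ (a : Fin n) → ∃ λ (b : Fin n) → ∃ λ (c : Fin n) → ∃ λ (d : Fin n) →
  a < b × b < c × c < d × π b < π d × π d < π a × π a < π c

Av3142 : {n : ℕ} → (Fin n → Fin n) → Set
Av3142 π = ¬ Contains3142 π

-- Elements are identified by their positions.
-- "x above y": value of x greater than value of y; "x left of y": x earlier.
module _ {n : ℕ} (π : Fin n → Fin n) where

  Above : Fin n → Fin n → Set
  Above x y = π y < π x

  Left : Fin n → Fin n → Set
  Left x y = x < y

  -- Condition (b) for block index i (1-based, i ≥ 2), by r = i mod 4.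
  -- blk assigns each element its (1-based) block index.
  SpiralCondB : (blk : Fin n → ℕ) (i : ℕ) → Set
  SpiralCondB blk i = go (i % 4)
    where
    InCur InPrev InGt : Fin n → Set
    InCur x = blk x ≡ i
    InPrev y = blk y ≡ ℕ.pred i
    InGt x = i ℕ.< blk x
    go : ℕ → Set
    go 0 = (∀ x y → InCur x → InPrev y → Above x y)
         × (∀ x y → InGt x → InPrev y → Above x y × Left x y)
    go 1 = (∀ x y → InCur x → InPrev y → Left x y)
         × (∀ x y → InGt x → InPrev y → Above y x × Left x y)
    go 2 = (∀ x y → InCur x → InPrev y → Above y x)
         × (∀ x y → InGt x → InPrev y → Above y x × Left y x)
    go _ = (∀ x y → InCur x → InPrev y → Left y x)
         × (∀ x y → InGt x → InPrev y → Above x y × Left y x)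

  -- A spiral decomposition with m (possibly empty) blocks B_1, …, B_m.
  record SpiralDecomposition (m : ℕ) : Set where
    field
      blk      : Fin n → ℕ
      blk-range : ∀ x → 1 ≤ blk x × blk x ≤ m
      cond-a   : ∀ x y → blk x ≡ blk y → x < y →
                   (blk x % 2 ≡ 1 → Above x y) × (blk x % 2 ≡ 0 → Above y x)
      cond-b   : ∀ i → 2 ≤ i → i ≤ m → SpiralCondB blk i

  Blue : Fin n → Fin n → Set
  Blue x y = suc (toℕ x) ≡ toℕ y ⊎ suc (toℕ y) ≡ toℕ x

  Red : Fin n → Fin n → Set
  Red x y = suc (toℕ (π x)) ≡ toℕ (π y) ⊎ suc (toℕ (π y)) ≡ toℕ (π x)

  Edge : Fin n → Fin n → Set
  Edge x y = Blue x y ⊎ Red x y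

  Good : (blk : Fin n → ℕ) → Fin n → Fin n → Set
  Good blk x y =
    let i = blk x ⊓ blk y ; j = blk x ⊔ blk y in
    i ≡ j
    ⊎ (Blue x y × i % 2 ≡ 1 × j ≡ suc i)
    ⊎ (Red x y × i % 2 ≡ 0 × j ≡ suc i)

  BadEdge : (blk : Fin n → ℕ) → Fin n → Fin n → Set
  BadEdge blk x y = Edge x y × ¬ Good blk x y

-- Let {a, b} be a bad edge with a in the lower block B_i.  Either b lies in
-- B_{>i+1}, or b lies in B_{i+1} and the edge has the colour that is not allowed
-- there: red if i is odd, blue if i is even.  By condition (b), B_i is
-- separated from B_{>i+1} both in position and in value, and it is separated
-- from B_{i+1} in value for odd i and in position for even i.  Between two sets
-- separated in some coordinate, at most one pair is adjacent in that
-- coordinate.  Hence each block is the lower block of at most three bad edges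
-- (far blue, far red, next-block), giving 3m ≤ 4m bad edges.
module Submission where

open import Defs
open import Data.Nat using (ℕ; suc; _≤_; _*_; _%_; z≤n; s≤s; s≤s⁻¹)
import Data.Nat as ℕ
open import Data.Nat.Properties
  using (≤-antisym; ≤-total; <-asym; n<1+n; <⇒≤; <-≤-trans; ≤-trans; *-monoʳ-≤; *-comm;
         ≤-reflexive; m≤n⇒m<n∨m≡n; m≤n⇒m⊓n≡m; m≤n⇒m⊔n≡n; ⊓-comm; ⊔-comm)
open import Data.Nat.DivMod using (m%n<n; %-distribˡ-+; m∣n⇒o%n%m≡o%m)
open import Data.Nat.Divisibility using (divides)
open import Data.Fin using (Fin; zero; suc; toℕ; fromℕ<; combine; _<_)
open import Data.Fin.Patterns using (0F; 1F; 2F)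
open import Data.Fin.Properties using (toℕ-injective; toℕ-fromℕ<; combine-injective; injective⇒≤)
import Data.Fin.Properties as Fin
open import Data.Product using (_×_; _,_; ∃; ∃₂; proj₁; proj₂; map₁)
import Data.Product as Product
open import Data.Sum using (_⊎_; inj₁; inj₂)
import Data.Sum as Sum
open import Data.List using (List; _∷_; length; lookup)
open import Data.List.Relation.Unary.All using (All)
import Data.List.Relation.Unary.All as All
open import Data.List.Relation.Unary.AllPairs using (_∷_)
open import Data.List.Relation.Unary.Unique.Propositional using (Unique)
open import Data.List.Membership.Propositional.Properties using (∈-lookup)
open import Relation.Nullary using (contradiction)
open import Relation.Binary.PropositionalEquality using (_≡_; refl; sym; trans; cong; subst; subst₂)
open import Function.Definitions using (Injective)

module _ {A : Set} where

  unique⇒lookup-injective : ∀ {xs : List A} → Unique xs → Injective _≡_ _≡_ (lookup xs)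
  unique⇒lookup-injective {x ∷ xs} _ {zero}  {zero}  _ = refl
  unique⇒lookup-injective {x ∷ xs} (x∉xs ∷ u) {zero}  {suc j} e = contradiction e (All.lookup x∉xs (∈-lookup j))
  unique⇒lookup-injective {x ∷ xs} (x∉xs ∷ u) {suc i} {zero}  e = contradiction (sym e) (All.lookup x∉xs (∈-lookup i))
  unique⇒lookup-injective {x ∷ xs} (x∉xs ∷ u) {suc i} {suc j} e = cong suc (unique⇒lookup-injective u e)

  length≤-of-encoding : ∀ {k} (R : A → Fin k → Set) → (∀ {a a' c} → R a c → R a' c → a ≡ a') →
                        ∀ {xs} → Unique xs → All (λ a → ∃ (R a)) xs → length xs ≤ k
  length≤-of-encoding {k} R decode {xs} u codes = injective⇒≤ code-injective
    where
    code : Fin (length xs) → Fin k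
    code i = proj₁ (All.lookup codes (∈-lookup i))

    code-injective : Injective _≡_ _≡_ code
    code-injective {i} {j} e = unique⇒lookup-injective u
      (decode (proj₂ (All.lookup codes (∈-lookup i)))
              (subst (R _) (sym e) (proj₂ (All.lookup codes (∈-lookup j)))))

Adjacent : ℕ → ℕ → Set
Adjacent u v = suc u ≡ v ⊎ suc v ≡ u

adjacent⇒≡suc : ∀ {u v} → v ℕ.< u → Adjacent u v → u ≡ suc v
adjacent⇒≡suc {u} v<u (inj₁ refl) = contradiction v<u (<-asym (n<1+n u))
adjacent⇒≡suc     _   (inj₂ refl) = refl

adjacent-pairs-≡ : ∀ {a b a' b'} → b ℕ.< a → b' ℕ.< a' → b ℕ.< a' → b' ℕ.< a →
                   Adjacent a b → Adjacent a' b' → a ≡ a' × b ≡ b'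
adjacent-pairs-≡ b<a b'<a' b<a' b'<a adj adj'
  with refl ← adjacent⇒≡suc b<a adj | refl ← adjacent⇒≡suc b'<a' adj' =
  let b≡b' = ≤-antisym (s≤s⁻¹ b<a') (s≤s⁻¹ b'<a) in cong suc b≡b' , b≡b'

module _ {A : Set} (f : A → ℕ) where

  Below : (A → Set) → (A → Set) → Set
  Below S T = ∀ {s t} → S s → T t → f s ℕ.< f t

  Separated : (A → Set) → (A → Set) → Set
  Separated S T = Below S T ⊎ Below T S

  separated-adjacent-unique : Injective _≡_ _≡_ f → ∀ {S T a b a' b'} → Separated S T →
                              S a → T b → S a' → T b' →
                              Adjacent (f a) (f b) → Adjacent (f a') (f b') → a ≡ a' × b ≡ b'
  separated-adjacent-unique f-inj (inj₁ S<T) a∈ b∈ a'∈ b'∈ adj adj' =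
    Product.map f-inj f-inj (Product.swap
      (adjacent-pairs-≡ (S<T a∈ b∈) (S<T a'∈ b'∈) (S<T a∈ b'∈) (S<T a'∈ b∈) (Sum.swap adj) (Sum.swap adj')))
  separated-adjacent-unique f-inj (inj₂ T<S) a∈ b∈ a'∈ b'∈ adj adj' =
    Product.map f-inj f-inj (adjacent-pairs-≡ (T<S b∈ a∈) (T<S b'∈ a'∈) (T<S b∈ a'∈) (T<S b'∈ a∈) adj adj')

suc-mod-4 : ∀ i → (i % 2 ≡ 1 → suc i % 4 ≡ 0 ⊎ suc i % 4 ≡ 2) × (i % 2 ≡ 0 → suc i % 4 ≡ 1 ⊎ suc i % 4 ≡ 3)
suc-mod-4 i = subst₂ Shape (m∣n⇒o%n%m≡o%m 2 4 i (divides 2 refl)) (sym (%-distribˡ-+ 1 i 4))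
                (residues (i % 4) (m%n<n i 4))
  where
  Shape : ℕ → ℕ → Set
  Shape p r = (p ≡ 1 → r ≡ 0 ⊎ r ≡ 2) × (p ≡ 0 → r ≡ 1 ⊎ r ≡ 3)

  residues : ∀ r → r ℕ.< 4 → Shape (r % 2) (suc r % 4)
  residues 0 _ = (λ ()) , (λ _ → inj₁ refl)
  residues 1 _ = (λ _ → inj₂ refl) , (λ ())
  residues 2 _ = (λ ()) , (λ _ → inj₂ refl)
  residues 3 _ = (λ _ → inj₁ refl) , (λ ())
  residues (suc (suc (suc (suc _)))) (s≤s (s≤s (s≤s (s≤s ()))))

parity : ∀ i → i % 2 ≡ 0 ⊎ i % 2 ≡ 1
parity i with i % 2 | m%n<n i 2
... | 0 | _ = inj₁ refl
... | 1 | _ = inj₂ refl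
... | suc (suc _) | s≤s (s≤s ())

suc-toℕ-onto : ∀ {j m} → 1 ≤ j → j ≤ m → ∃ λ (i : Fin m) → j ≡ suc (toℕ i)
suc-toℕ-onto (s≤s _) k<m = fromℕ< k<m , cong suc (sym (toℕ-fromℕ< k<m))

module SpiralBadEdges {n m : ℕ} (π : Fin n → Fin n) (π-injective : IsPerm π)
                      (D : SpiralDecomposition π m) where
  open SpiralDecomposition D

  pos val : Fin n → ℕ
  pos = toℕ
  val z = toℕ (π z)

  val-injective : Injective _≡_ _≡_ val
  val-injective e = π-injective (toℕ-injective e)

  InBlock Beyond : ℕ → Fin n → Set
  InBlock i z = blk z ≡ i
  Beyond i z = i ℕ.< blk z

  far-separated : ∀ {i a b} → InBlock i a → Beyond (suc i) b →
                  Separated pos (InBlock i) (Beyond (suc i)) × Separated val (InBlock i) (Beyond (suc i))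
  far-separated {i} {a} {b} a∈ b∈
    with suc i % 4
       | cond-b (suc i) (s≤s (subst (1 ≤_) a∈ (proj₁ (blk-range a))))
                        (<⇒≤ (<-≤-trans b∈ (proj₂ (blk-range b))))
  ... | 0 | _ , q = inj₂ (λ u∈ v∈ → proj₂ (q _ _ u∈ v∈)) , inj₁ (λ s∈ t∈ → proj₁ (q _ _ t∈ s∈))
  ... | 1 | _ , q = inj₂ (λ u∈ v∈ → proj₂ (q _ _ u∈ v∈)) , inj₂ (λ u∈ v∈ → proj₁ (q _ _ u∈ v∈))
  ... | 2 | _ , q = inj₁ (λ s∈ t∈ → proj₂ (q _ _ t∈ s∈)) , inj₂ (λ u∈ v∈ → proj₁ (q _ _ u∈ v∈))
  ... | suc (suc (suc _)) | _ , q = inj₁ (λ s∈ t∈ → proj₂ (q _ _ t∈ s∈)) , inj₁ (λ s∈ t∈ → proj₁ (q _ _ t∈ s∈))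

  next-separated : ∀ {i a b} → InBlock i a → InBlock (suc i) b →
                   (i % 2 ≡ 1 → Separated val (InBlock i) (InBlock (suc i))) ×
                   (i % 2 ≡ 0 → Separated pos (InBlock i) (InBlock (suc i)))
  next-separated {i} {a} {b} a∈ b∈
    with suc i % 4
       | cond-b (suc i) (s≤s (subst (1 ≤_) a∈ (proj₁ (blk-range a))))
                        (subst (_≤ m) b∈ (proj₂ (blk-range b)))
       | suc-mod-4 i
  ... | 0 | p , _ | _ , even =
    (λ _ → inj₁ (λ s∈ t∈ → p _ _ t∈ s∈)) , (λ e → contradiction (even e) λ { (inj₁ ()) ; (inj₂ ()) })
  ... | 1 | p , _ | odd , _ =
    (λ o → contradiction (odd o) λ { (inj₁ ()) ; (inj₂ ()) }) , (λ _ → inj₂ (p _ _))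
  ... | 2 | p , _ | _ , even =
    (λ _ → inj₂ (p _ _)) , (λ e → contradiction (even e) λ { (inj₁ ()) ; (inj₂ ()) })
  ... | suc (suc (suc _)) | p , _ | odd , _ =
    (λ o → contradiction (odd o) λ { (inj₁ ()) ; (inj₂ ()) }) , (λ _ → inj₁ (λ s∈ t∈ → p _ _ t∈ s∈))

  -- i is the block of the lower endpoint a.
  data BadEdgeFrom (i : ℕ) (a b : Fin n) : Fin 3 → Set where
    far-blue  : Beyond (suc i) b → Blue π a b → BadEdgeFrom i a b 0F
    far-red   : Beyond (suc i) b → Red π a b → BadEdgeFrom i a b 1F
    next-red  : InBlock (suc i) b → i % 2 ≡ 1 → Red π a b → BadEdgeFrom i a b 2F
    next-blue : InBlock (suc i) b → i % 2 ≡ 0 → Blue π a b → BadEdgeFrom i a b 2F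

  badEdgeFrom-unique : ∀ {i a b a' b' k} → InBlock i a → InBlock i a' →
                       BadEdgeFrom i a b k → BadEdgeFrom i a' b' k → a ≡ a' × b ≡ b'
  badEdgeFrom-unique a∈ a'∈ (far-blue b∈ e) (far-blue b'∈ e') =
    separated-adjacent-unique pos toℕ-injective (proj₁ (far-separated a∈ b∈)) a∈ b∈ a'∈ b'∈ e e'
  badEdgeFrom-unique a∈ a'∈ (far-red b∈ e) (far-red b'∈ e') =
    separated-adjacent-unique val val-injective (proj₂ (far-separated a∈ b∈)) a∈ b∈ a'∈ b'∈ e e'
  badEdgeFrom-unique a∈ a'∈ (next-red b∈ odd e) (next-red b'∈ _ e') =
    separated-adjacent-unique val val-injective (proj₁ (next-separated a∈ b∈) odd) a∈ b∈ a'∈ b'∈ e e'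
  badEdgeFrom-unique a∈ a'∈ (next-blue b∈ even e) (next-blue b'∈ _ e') =
    separated-adjacent-unique pos toℕ-injective (proj₂ (next-separated a∈ b∈) even) a∈ b∈ a'∈ b'∈ e e'
  badEdgeFrom-unique _ _ (next-red _ odd _) (next-blue _ even _) = contradiction (trans (sym odd) even) λ ()
  badEdgeFrom-unique _ _ (next-blue _ even _) (next-red _ odd _) = contradiction (trans (sym odd) even) λ ()

  GoodBetween : Fin n → Fin n → ℕ → ℕ → Set
  GoodBetween x y i j = i ≡ j ⊎ (Blue π x y × i % 2 ≡ 1 × j ≡ suc i) ⊎ (Red π x y × i % 2 ≡ 0 × j ≡ suc i)

  good-ascending : ∀ {a b} → blk a ≤ blk b → GoodBetween a b (blk a) (blk b) → Good π blk a b
  good-ascending le = subst₂ (GoodBetween _ _) (sym (m≤n⇒m⊓n≡m le)) (sym (m≤n⇒m⊔n≡n le))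

  good-sym : ∀ {x y} → Good π blk x y → Good π blk y x
  good-sym {x} {y} g = subst₂ (GoodBetween y x) (⊓-comm (blk x) (blk y)) (⊔-comm (blk x) (blk y))
    (Sum.map₂ (Sum.map (map₁ Sum.swap) (map₁ Sum.swap)) g)

  badEdge-sym : ∀ {x y} → BadEdge π blk x y → BadEdge π blk y x
  badEdge-sym (edge , ¬good) = Sum.map Sum.swap Sum.swap edge , λ g → ¬good (good-sym g)

  badEdgeFrom : ∀ {a b} → blk a ≤ blk b → BadEdge π blk a b → ∃ (BadEdgeFrom (blk a) a b)
  badEdgeFrom {a} {b} le (edge , ¬good) with m≤n⇒m<n∨m≡n le
  ... | inj₂ same = contradiction (good-ascending le (inj₁ same)) ¬good
  ... | inj₁ lt with m≤n⇒m<n∨m≡n lt | edge | parity (blk a)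
  ...   | inj₁ far | inj₁ blue | _ = 0F , far-blue far blue
  ...   | inj₁ far | inj₂ red  | _ = 1F , far-red far red
  ...   | inj₂ next | inj₂ red  | inj₂ odd  = 2F , next-red (sym next) odd red
  ...   | inj₂ next | inj₁ blue | inj₁ even = 2F , next-blue (sym next) even blue
  ...   | inj₂ next | inj₁ blue | inj₂ odd  =
    contradiction (good-ascending le (inj₂ (inj₁ (blue , odd , sym next)))) ¬good
  ...   | inj₂ next | inj₂ red  | inj₁ even =
    contradiction (good-ascending le (inj₂ (inj₂ (red , even , sym next)))) ¬good

  Endpoints : Fin n → Fin n → Fin n → Fin n → Set
  Endpoints x y a b = (a ≡ x × b ≡ y) ⊎ (a ≡ y × b ≡ x)

  endpoints-unique : ∀ {x y x' y' a b} → x < y → x' < y' →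
                     Endpoints x y a b → Endpoints x' y' a b → (x , y) ≡ (x' , y')
  endpoints-unique _   _     (inj₁ (refl , refl)) (inj₁ (refl , refl)) = refl
  endpoints-unique _   _     (inj₂ (refl , refl)) (inj₂ (refl , refl)) = refl
  endpoints-unique x<y x'<y' (inj₁ (refl , refl)) (inj₂ (refl , refl)) = contradiction x'<y' (Fin.<-asym x<y)
  endpoints-unique x<y x'<y' (inj₂ (refl , refl)) (inj₁ (refl , refl)) = contradiction x'<y' (Fin.<-asym x<y)

  ascending : ∀ {x y} → BadEdge π blk x y → ∃₂ λ a b → Endpoints x y a b × blk a ≤ blk b × BadEdge π blk a b
  ascending {x} {y} bad with ≤-total (blk x) (blk y)
  ... | inj₁ le = x , y , inj₁ (refl , refl) , le , bad
  ... | inj₂ ge = y , x , inj₂ (refl , refl) , ge , badEdge-sym bad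

  Encodes : Fin n × Fin n → Fin (m * 3) → Set
  Encodes (x , y) c = x < y × ∃₂ λ a b → Endpoints x y a b ×
    ∃₂ λ (i : Fin m) k → c ≡ combine i k × InBlock (suc (toℕ i)) a × BadEdgeFrom (suc (toℕ i)) a b k

  encodes-unique : ∀ {q q' c} → Encodes q c → Encodes q' c → q ≡ q'
  encodes-unique (x<y , a , b , ends , i , k , refl , a∈ , bad) (x'<y' , a' , b' , ends' , i' , k' , e , a'∈ , bad')
    with refl , refl ← combine-injective i k i' k' e
    with refl , refl ← badEdgeFrom-unique a∈ a'∈ bad bad' = endpoints-unique x<y x'<y' ends ends'

  encode : ∀ {x y} → x < y → BadEdge π blk x y → ∃ (Encodes (x , y))
  encode x<y bad with a , b , ends , le , bad' ← ascending bad
                 with k , kind ← badEdgeFrom le bad'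
                 with i , a∈ ← suc-toℕ-onto (proj₁ (blk-range a)) (proj₂ (blk-range a)) =
    combine i k , x<y , a , b , ends , i , k , refl , a∈ , subst (λ j → BadEdgeFrom j a b k) a∈ kind

lemma10 : (n m : ℕ) (π : Fin n → Fin n) → IsPerm π → InC11 π → Av3142 π →
    (D : SpiralDecomposition π m) →
    (L : List (Fin n × Fin n)) → Unique L →
    All (λ { (x , y) → x < y × BadEdge π (SpiralDecomposition.blk D) x y }) L →
    length L ≤ 4 * m
lemma10 n m π π-injective _ _ D L unique bad = ≤-trans
  (length≤-of-encoding Encodes encodes-unique unique (All.map (λ { {x , y} (x<y , b) → encode x<y b }) bad))
  (≤-trans (*-monoʳ-≤ m (s≤s (s≤s (s≤s z≤n)))) (≤-reflexive (*-comm m 4)))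
  where open SpiralBadEdges π π-injective D
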